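{- Let $\Gamma$ and $\Sigma$ be graphs with $V(\Sigma)=\{1,\dots,n\}$, $n\ge 2$. Then $P(\Gamma,\Sigma)\cong\mathrm{Aut}_\Sigma(\Gamma)\rtimes\mathrm{Aut}(\Sigma)$.
   Context: Graphs are finite and simple. The direct product $\Gamma\times\Sigma$ has vertex set $V(\Gamma)\times V(\Sigma)$, with $(u,x)\sim(v,y)$ iff $u\sim v$ in $\Gamma$ and $x\sim y$ in $\Sigma$. An $n$-tuple $(\alpha_1,\dots,\alpha_n)$ of permutations of $V(\Gamma)$ is a $\Sigma$-automorphism of $\Gamma$ if for all $u,v\in V(\Gamma)$: $\{u,v\}\in E(\Gamma)$ iff $\{u^{\alpha_i},v^{\alpha_j}\}\in E(\Gamma)$ for all $i,j$ with $\{i,j\}\in E(\Sigma)$; these form a group $\mathrm{Aut}_\Sigma(\Gamma)$ under coordinatewise composition. $P(\Gamma,\Sigma)$ is the set of elements of $\mathrm{Aut}(\Gamma\times\Sigma)$ that leave the partition $\{V(\Gamma)\times\{i\}: i\in V(\Sigma)\}$ of $V(\Gamma\times\Sigma)$ invariant (i.e. permute its blocks). -}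

module Defs where

open import Data.Nat using (ℕ)
open import Data.Fin using (Fin)
open import Data.Bool using (Bool; true; false; _∧_)
open import Data.Product using (Σ; _×_; _,_; proj₁; proj₂; ∃-syntax)
open import Function.Bundles using (_↔_; _⇔_; Inverse)
open import Relation.Binary.PropositionalEquality using (_≡_; refl; cong₂)

record Graph (V : Set) : Set where
  field
    adj        : V → V → Bool
    adj-sym    : ∀ u v → adj u v ≡ adj v u
    adj-irrefl : ∀ u → adj u u ≡ false

  _~_ : V → V → Set
  u ~ v = adj u v ≡ true

open Graph public using (adj)

Edge : {V : Set} → Graph V → V → V → Set
Edge G u v = Graph.adj G u v ≡ true

_×ᵍ_ : {V W : Set} → Graph V → Graph W → Graph (V × W)
Graph.adj (Γ ×ᵍ Σ') (u , x) (v , y) = adj Γ u v ∧ adj Σ' x y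
Graph.adj-sym (Γ ×ᵍ Σ') (u , x) (v , y) =
  cong₂ _∧_ (Graph.adj-sym Γ u v) (Graph.adj-sym Σ' x y)
Graph.adj-irrefl (Γ ×ᵍ Σ') (u , x) rewrite Graph.adj-irrefl Γ u = refl

Perm : Set → Set
Perm A = A ↔ A

_⟨$⟩_ : {A : Set} → Perm A → A → A
σ ⟨$⟩ a = Inverse.to σ a

IsAut : {V : Set} → Graph V → Perm V → Set
IsAut G σ = ∀ u v → (Edge G u v ⇔ Edge G (σ ⟨$⟩ u) (σ ⟨$⟩ v))

IsΣAut : {m n : ℕ} → Graph (Fin m) → Graph (Fin n) → (Fin n → Perm (Fin m)) → Set
IsΣAut Γ Σ' α = ∀ u v i j → Edge Σ' i j →
  (Edge Γ u v ⇔ Edge Γ (α i ⟨$⟩ u) (α j ⟨$⟩ v))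

-- φ leaves the partition {V(Γ)×{i}} invariant: the image of each block is a block.
PreservesBlocks : {m n : ℕ} → Perm (Fin m × Fin n) → Set
PreservesBlocks {m} {n} φ =
  ∀ (i : Fin n) → ∃[ j ] ∀ (y : Fin m × Fin n) →
    ((∃[ u ] φ ⟨$⟩ (u , i) ≡ y) ⇔ proj₂ y ≡ j)

AutG : {V : Set} → Graph V → Set
AutG G = Σ (Perm _) (IsAut G)

AutΣG : {m n : ℕ} → Graph (Fin m) → Graph (Fin n) → Set
AutΣG Γ Σ' = Σ (Fin _ → Perm (Fin _)) (IsΣAut Γ Σ')

PGS : {m n : ℕ} → Graph (Fin m) → Graph (Fin n) → Set
PGS Γ Σ' = Σ (Perm _) (λ φ → IsAut (Γ ×ᵍ Σ') φ × PreservesBlocks φ)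

SemiDirect : {m n : ℕ} → Graph (Fin m) → Graph (Fin n) → Set
SemiDirect Γ Σ' = AutΣG Γ Σ' × AutG Σ'

_≈P_ : {m n : ℕ} {Γ : Graph (Fin m)} {Σ' : Graph (Fin n)} → PGS Γ Σ' → PGS Γ Σ' → Set
(φ , _) ≈P (ψ , _) = ∀ x → φ ⟨$⟩ x ≡ ψ ⟨$⟩ x

_≈S_ : {m n : ℕ} {Γ : Graph (Fin m)} {Σ' : Graph (Fin n)} →
       SemiDirect Γ Σ' → SemiDirect Γ Σ' → Set
((α , _) , (τ , _)) ≈S ((β , _) , (ρ , _)) =
  (∀ i u → α i ⟨$⟩ u ≡ β i ⟨$⟩ u) × (∀ i → τ ⟨$⟩ i ≡ ρ ⟨$⟩ i)

-- Permutations act on the right (u^{αβ} = (u^α)^β).  Stated relationally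
-- ("χ is the product φψ") so that closure need not be proved here.
IsProdP : {m n : ℕ} {Γ : Graph (Fin m)} {Σ' : Graph (Fin n)} →
          PGS Γ Σ' → PGS Γ Σ' → PGS Γ Σ' → Set
IsProdP (φ , _) (ψ , _) (χ , _) = ∀ x → χ ⟨$⟩ x ≡ ψ ⟨$⟩ (φ ⟨$⟩ x)

-- In Aut_Σ(Γ) ⋊ Aut(Σ), with Aut(Σ) acting by permuting coordinates:
-- (α, τ)(β, ρ) = ((αᵢ β_{i^τ})ᵢ , τρ).
IsProdS : {m n : ℕ} {Γ : Graph (Fin m)} {Σ' : Graph (Fin n)} →
          SemiDirect Γ Σ' → SemiDirect Γ Σ' → SemiDirect Γ Σ' → Set
IsProdS ((α , _) , (τ , _)) ((β , _) , (ρ , _)) ((γ , _) , (κ , _)) =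
  (∀ i u → γ i ⟨$⟩ u ≡ β (τ ⟨$⟩ i) ⟨$⟩ (α i ⟨$⟩ u)) ×
  (∀ i → κ ⟨$⟩ i ≡ ρ ⟨$⟩ (τ ⟨$⟩ i))

record PIsoSemiDirect {m n : ℕ} (Γ : Graph (Fin m)) (Σ' : Graph (Fin n)) : Set where
  field
    F         : PGS Γ Σ' → SemiDirect Γ Σ'
    F-cong    : ∀ φ ψ → _≈P_ {Γ = Γ} {Σ' = Σ'} φ ψ → _≈S_ {Γ = Γ} {Σ' = Σ'} (F φ) (F ψ)
    F-inj     : ∀ φ ψ → _≈S_ {Γ = Γ} {Σ' = Σ'} (F φ) (F ψ) → _≈P_ {Γ = Γ} {Σ' = Σ'} φ ψ
    F-surj    : ∀ s → ∃[ φ ] _≈S_ {Γ = Γ} {Σ' = Σ'} (F φ) s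
    F-hom     : ∀ φ ψ χ → IsProdP {Γ = Γ} {Σ' = Σ'} φ ψ χ →
                IsProdS {Γ = Γ} {Σ' = Σ'} (F φ) (F ψ) (F χ)

{-# OPTIONS --safe #-}
-- A block-preserving automorphism φ of Γ × Σ acts as (u , i) ↦ (αᵢ u , τ i) for
-- permutations αᵢ of V(Γ) and τ of V(Σ), and these components are determined by φ.
-- Because Γ has an edge u₀ ~ v₀, adjacency of (u₀ , i) and (v₀ , j) reduces to i ~ j,
-- so τ ∈ Aut(Σ); then, for i ~ j, adjacency of (u , i) and (v , j) reduces to u ~ v,
-- so (αᵢ)ᵢ ∈ Aut_Σ(Γ).  Conversely every such pair (α , τ) defines a block-preserving
-- automorphism, and composing two of them composes the components by the
-- semidirect product rule (α , τ)(β , ρ) = ((αᵢ β_{τ i})ᵢ , τρ).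
module Submission where

open import Defs
open import Data.Nat using (ℕ; _≤_)
open import Data.Fin using (Fin)
open import Data.Bool.Properties using (T-≡; T-∧)
open import Data.Product using (∃-syntax; _×_; _,_; proj₁; proj₂)
open import Data.Product.Function.NonDependent.Propositional using (_×-⇔_)
open import Function using (_∘_)
open import Function.Bundles using (_⇔_; Inverse; Equivalence; mk⇔; mk↔ₛ′)
open import Function.Construct.Composition using (_⇔-∘_)
open import Function.Construct.Symmetry using (⇔-sym)
open import Relation.Binary.PropositionalEquality

open Inverse using (strictlyInverseˡ; strictlyInverseʳ)
open Equivalence using (to; from)

private variable
  A I : Set

Splits : (A × I → A × I) → (I → A → A) → (I → I) → Set
Splits f a t = ∀ u i → f (u , i) ≡ (a i u , t i)

module _ {f g : A × I → A × I} {a b : I → A → A} {t s : I → I}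
         (f-splits : Splits f a t) (g-splits : Splits g b s) where

  splits-≗ : (∀ i u → a i u ≡ b i u) → (∀ i → t i ≡ s i) → f ≗ g
  splits-≗ a≗b t≗s (u , i) =
    trans (f-splits u i) (trans (cong₂ _,_ (a≗b i u) (t≗s i)) (sym (g-splits u i)))

  splits-unique : A → f ≗ g → (∀ i u → a i u ≡ b i u) × (∀ i → t i ≡ s i)
  splits-unique u₀ f≗g = (λ i u → cong proj₁ (components u i)) , (λ i → cong proj₂ (components u₀ i))
    where
    components : ∀ u i → (a i u , t i) ≡ (b i u , s i)
    components u i = trans (sym (f-splits u i)) (trans (f≗g (u , i)) (g-splits u i))

  splits-∘ : Splits (g ∘ f) (λ i → b (t i) ∘ a i) (s ∘ t)
  splits-∘ u i = trans (cong g (f-splits u i)) (g-splits (a i u) (t i))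

twist : (I → Perm A) → Perm I → Perm (A × I)
twist {I = I} {A = A} α τ = mk↔ₛ′ forth back forth∘back back∘forth
  where
  forth : A × I → A × I
  forth (u , i) = (α i ⟨$⟩ u , τ ⟨$⟩ i)

  back : A × I → A × I
  back (a , k) = (Inverse.from (α (Inverse.from τ k)) a , Inverse.from τ k)

  forth∘back : ∀ x → forth (back x) ≡ x
  forth∘back (a , k) =
    cong₂ _,_ (strictlyInverseˡ (α (Inverse.from τ k)) a) (strictlyInverseˡ τ k)

  back∘forth : ∀ x → back (forth x) ≡ x
  back∘forth (u , i) = back-at (strictlyInverseʳ τ i)
    where
    back-at : ∀ {j} → j ≡ i → (Inverse.from (α j) (α i ⟨$⟩ u) , j) ≡ (u , i)
    back-at refl = cong (_, i) (strictlyInverseʳ (α i) u)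

twist-splits : (α : I → Perm A) (τ : Perm I) →
               Splits (twist α τ ⟨$⟩_) (λ i → α i ⟨$⟩_) (τ ⟨$⟩_)
twist-splits _ _ _ _ = refl

twist-preservesBlocks : ∀ {m n} (α : Fin n → Perm (Fin m)) (τ : Perm (Fin n)) →
                        PreservesBlocks (twist α τ)
twist-preservesBlocks α τ i = τ ⟨$⟩ i , λ y → mk⇔
  (λ (_ , e) → sym (cong proj₂ e))
  (λ e → Inverse.from (α i) (proj₁ y) , cong₂ _,_ (strictlyInverseˡ (α i) (proj₁ y)) (sym e))

-- The point u₀ is only needed to invert the block permutation.
module BlockDecomposition {m n : ℕ} (φ : Perm (Fin m × Fin n)) (φ-blocks : PreservesBlocks φ)
                          (u₀ : Fin m) where

  φ⁻¹ : Fin m × Fin n → Fin m × Fin n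
  φ⁻¹ = Inverse.from φ

  blockMap : Fin n → Fin n
  blockMap i = proj₁ (φ-blocks i)

  fibreMap : Fin n → Fin m → Fin m
  fibreMap i u = proj₁ (φ ⟨$⟩ (u , i))

  φ-in-block : ∀ u i → proj₂ (φ ⟨$⟩ (u , i)) ≡ blockMap i
  φ-in-block u i = to (proj₂ (φ-blocks i) _) (u , refl)

  preimage : ∀ i a → ∃[ u ] φ ⟨$⟩ (u , i) ≡ (a , blockMap i)
  preimage i a = from (proj₂ (φ-blocks i) (a , blockMap i)) refl

  φ⁻¹-block : ∀ i a → φ⁻¹ (a , blockMap i) ≡ (proj₁ (preimage i a) , i)
  φ⁻¹-block i a = trans (cong φ⁻¹ (sym (proj₂ (preimage i a)))) (strictlyInverseʳ φ _)

  splits : Splits (φ ⟨$⟩_) fibreMap blockMap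
  splits u i = cong (fibreMap i u ,_) (φ-in-block u i)

  fibrePerm : Fin n → Perm (Fin m)
  fibrePerm i = mk↔ₛ′ (fibreMap i) fibreMap⁻¹ inverseˡ inverseʳ
    where
    fibreMap⁻¹ : Fin m → Fin m
    fibreMap⁻¹ a = proj₁ (φ⁻¹ (a , blockMap i))

    inverseˡ : ∀ a → fibreMap i (fibreMap⁻¹ a) ≡ a
    inverseˡ a = trans (cong (fibreMap i ∘ proj₁) (φ⁻¹-block i a))
                       (cong proj₁ (proj₂ (preimage i a)))

    inverseʳ : ∀ u → fibreMap⁻¹ (fibreMap i u) ≡ u
    inverseʳ u = cong proj₁ (trans (cong φ⁻¹ (sym (splits u i))) (strictlyInverseʳ φ (u , i)))

  blockPerm : Perm (Fin n)
  blockPerm = mk↔ₛ′ blockMap blockMap⁻¹ inverseˡ inverseʳ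
    where
    blockMap⁻¹ : Fin n → Fin n
    blockMap⁻¹ k = proj₂ (φ⁻¹ (u₀ , k))

    inverseˡ : ∀ k → blockMap (blockMap⁻¹ k) ≡ k
    inverseˡ k = trans (sym (φ-in-block _ _)) (cong proj₂ (strictlyInverseˡ φ (u₀ , k)))

    inverseʳ : ∀ i → blockMap⁻¹ (blockMap i) ≡ i
    inverseʳ i = cong proj₂ (φ⁻¹-block i u₀)

×ᵍ-edge⇔ : ∀ {V W} (Γ : Graph V) (Σ' : Graph W) {u v x y} →
           Edge (Γ ×ᵍ Σ') (u , x) (v , y) ⇔ (Edge Γ u v × Edge Σ' x y)
×ᵍ-edge⇔ _ _ = (T-≡ ×-⇔ T-≡) ⇔-∘ (T-∧ ⇔-∘ ⇔-sym T-≡)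

module _ {m n : ℕ} (Γ : Graph (Fin m)) (Σ' : Graph (Fin n))
         (φ : Perm (Fin m × Fin n)) (α : Fin n → Perm (Fin m)) (τ : Perm (Fin n))
         (φ-splits : Splits (φ ⟨$⟩_) (λ i → α i ⟨$⟩_) (τ ⟨$⟩_)) where

  image-edge⇔ : ∀ u v i j →
    Edge (Γ ×ᵍ Σ') (φ ⟨$⟩ (u , i)) (φ ⟨$⟩ (v , j)) ⇔
    (Edge Γ (α i ⟨$⟩ u) (α j ⟨$⟩ v) × Edge Σ' (τ ⟨$⟩ i) (τ ⟨$⟩ j))
  image-edge⇔ u v i j rewrite φ-splits u i | φ-splits v j = ×ᵍ-edge⇔ Γ Σ'

  isAut-×ᵍ⇒ : (∃[ u ] ∃[ v ] Edge Γ u v) → IsAut (Γ ×ᵍ Σ') φ → IsΣAut Γ Σ' α × IsAut Σ' τ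
  isAut-×ᵍ⇒ (u₀ , v₀ , u₀~v₀) φ-aut = α-aut , τ-aut
    where
    edge⇔image-edge : ∀ u v i j →
      (Edge Γ u v × Edge Σ' i j) ⇔ (Edge Γ (α i ⟨$⟩ u) (α j ⟨$⟩ v) × Edge Σ' (τ ⟨$⟩ i) (τ ⟨$⟩ j))
    edge⇔image-edge u v i j =
      image-edge⇔ u v i j ⇔-∘ (φ-aut (u , i) (v , j) ⇔-∘ ⇔-sym (×ᵍ-edge⇔ Γ Σ'))

    -- For the converse, pull the edge u₀ ~ v₀ back along αᵢ and αⱼ.
    τ-aut : IsAut Σ' τ
    τ-aut i j = mk⇔ (λ i~j → proj₂ (to (edge⇔image-edge u₀ v₀ i j) (u₀~v₀ , i~j)))
                    (λ τi~τj → proj₂ (from (edge⇔image-edge u v i j) (αu~αv , τi~τj)))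
      where
      u = Inverse.from (α i) u₀
      v = Inverse.from (α j) v₀
      αu~αv : Edge Γ (α i ⟨$⟩ u) (α j ⟨$⟩ v)
      αu~αv = subst₂ (Edge Γ) (sym (strictlyInverseˡ (α i) u₀)) (sym (strictlyInverseˡ (α j) v₀)) u₀~v₀

    α-aut : IsΣAut Γ Σ' α
    α-aut u v i j i~j = mk⇔
      (λ u~v → proj₁ (to (edge⇔image-edge u v i j) (u~v , i~j)))
      (λ αu~αv → proj₁ (from (edge⇔image-edge u v i j) (αu~αv , to (τ-aut i j) i~j)))

  isAut-×ᵍ⇐ : IsΣAut Γ Σ' α → IsAut Σ' τ → IsAut (Γ ×ᵍ Σ') φ
  isAut-×ᵍ⇐ α-aut τ-aut (u , i) (v , j) =
    ⇔-sym (image-edge⇔ u v i j) ⇔-∘ (componentwise ⇔-∘ ×ᵍ-edge⇔ Γ Σ')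
    where
    componentwise : (Edge Γ u v × Edge Σ' i j) ⇔
                    (Edge Γ (α i ⟨$⟩ u) (α j ⟨$⟩ v) × Edge Σ' (τ ⟨$⟩ i) (τ ⟨$⟩ j))
    componentwise = mk⇔
      (λ (u~v , i~j) → to (α-aut u v i j i~j) u~v , to (τ-aut i j) i~j)
      (λ (αu~αv , τi~τj) → let i~j = from (τ-aut i j) τi~τj in
                           from (α-aut u v i j i~j) αu~αv , i~j)

module _ {m n : ℕ} (Γ : Graph (Fin m)) (Σ' : Graph (Fin n)) (edge : ∃[ u ] ∃[ v ] Edge Γ u v) where

  private
    u₀ : Fin m
    u₀ = proj₁ edge

  decompose : PGS Γ Σ' → SemiDirect Γ Σ'
  decompose (φ , φ-aut , φ-blocks) =
    (fibrePerm , proj₁ components-aut) , (blockPerm , proj₂ components-aut)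
    where
    open BlockDecomposition φ φ-blocks u₀
    components-aut : IsΣAut Γ Σ' fibrePerm × IsAut Σ' blockPerm
    components-aut = isAut-×ᵍ⇒ Γ Σ' φ fibrePerm blockPerm splits edge φ-aut

  compose : SemiDirect Γ Σ' → PGS Γ Σ'
  compose ((α , α-aut) , (τ , τ-aut)) =
    twist α τ ,
    isAut-×ᵍ⇐ Γ Σ' (twist α τ) α τ (twist-splits α τ) α-aut τ-aut ,
    twist-preservesBlocks α τ

  SplitsAs : PGS Γ Σ' → SemiDirect Γ Σ' → Set
  SplitsAs (φ , _) ((α , _) , (τ , _)) = Splits (φ ⟨$⟩_) (λ i → α i ⟨$⟩_) (τ ⟨$⟩_)

  decompose-splits : ∀ p → SplitsAs p (decompose p)
  decompose-splits (φ , _ , φ-blocks) = BlockDecomposition.splits φ φ-blocks u₀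

  P≅AutΣ⋊Aut : PIsoSemiDirect Γ Σ'
  P≅AutΣ⋊Aut = record
    { F      = decompose
    ; F-cong = λ φ ψ → splits-unique (decompose-splits φ) (decompose-splits ψ) u₀
    ; F-inj  = λ φ ψ (α≗β , τ≗ρ) → splits-≗ (decompose-splits φ) (decompose-splits ψ) α≗β τ≗ρ
    ; F-surj = λ s@((α , _) , (τ , _)) → compose s ,
        splits-unique (decompose-splits (compose s)) (twist-splits α τ) u₀ (λ _ → refl)
    ; F-hom  = λ φ ψ χ χ≗ψ∘φ →
        splits-unique (decompose-splits χ) (splits-∘ (decompose-splits φ) (decompose-splits ψ)) u₀ χ≗ψ∘φ
    }

lemma2p4 : (m n : ℕ) → 2 ≤ n → (Γ : Graph (Fin m)) → (Σ' : Graph (Fin n)) →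
    (∃[ u ] ∃[ v ] Edge Γ u v) →
    PIsoSemiDirect Γ Σ'
lemma2p4 _ _ _ = P≅AutΣ⋊Aut
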